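{- Let $D$ be a (not necessarily simple) $3$-regular acyclic directed graph with a unique source and a unique sink, containing a directed Hamiltonian path $y_1\to y_2\to\cdots\to y_{m}$. Then $D$ is not $3$-edge connected if and only if at least one of the following holds: (1) there is an initial segment $\{y_1,\dots,y_k\}$ of the ordering in which there are strictly more vertices of indegree two than vertices of outdegree two; (2) there is an interval $[y_i,y_j]=\{y_i,y_{i+1},\dots,y_j\}$ with $2\le i\le j\le m-1$ such that the only edges with exactly one endpoint in this interval are the two edges $(y_{i-1},y_i)$ and $(y_j,y_{j+1})$.
   Context: A directed multigraph is $3$-regular if every vertex is incident to exactly three edges counted with multiplicity (in-edges plus out-edges). It is $3$-edge connected if its underlying undirected multigraph remains connected after deleting any two edges. Acyclic means no directed cycle. An initial segment of the Hamiltonian path ordering is a set $\{y_1,\dots,y_k\}$ of the first $k$ vertices. -}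

module Defs where

open import Data.Nat using (ℕ; zero; suc; _+_; _≤_; _<_)
open import Data.Fin using (Fin; toℕ)
open import Data.Fin.Properties using (_≟_)
open import Data.List using (List; length; filter; allFin)
open import Data.Product using (Σ; ∃; _×_; _,_)
open import Data.Sum using (_⊎_)
open import Relation.Nullary using (¬_)
open import Relation.Binary.PropositionalEquality using (_≡_; _≢_)
open import Function.Definitions using (Injective)

record Digraph (m : ℕ) : Set where
  field
    E   : ℕ
    src : Fin E → Fin m
    tgt : Fin E → Fin m

open Digraph public

module _ {m : ℕ} (D : Digraph m) where

  indeg : Fin m → ℕ
  indeg v = length (filter (λ e → tgt D e ≟ v) (allFin (E D)))

  outdeg : Fin m → ℕ
  outdeg v = length (filter (λ e → src D e ≟ v) (allFin (E D)))

  ThreeRegular : Set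
  ThreeRegular = ∀ v → indeg v + outdeg v ≡ 3

  data DWalk : Fin m → Fin m → ℕ → Set where
    nil  : ∀ {v} → DWalk v v 0
    cons : ∀ {w n} (e : Fin (E D)) → DWalk (tgt D e) w n → DWalk (src D e) w (suc n)

  Acyclic : Set
  Acyclic = ∀ v n → ¬ DWalk v v (suc n)

  UniqueSource : Set
  UniqueSource = Σ (Fin m) λ s → indeg s ≡ 0 × (∀ w → indeg w ≡ 0 → w ≡ s)

  UniqueSink : Set
  UniqueSink = Σ (Fin m) λ t → outdeg t ≡ 0 × (∀ w → outdeg w ≡ 0 → w ≡ t)

  -- a directed Hamiltonian path y₁ → y₂ → ⋯ → yₘ, given as an injective
  -- (hence bijective) ordering y of the vertices with an edge y i → y (i+1)
  IsHamiltonianPath : (Fin m → Fin m) → Set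
  IsHamiltonianPath y =
    Injective _≡_ _≡_ y ×
    (∀ (i j : Fin m) → toℕ j ≡ suc (toℕ i) →
       Σ (Fin (E D)) λ e → src D e ≡ y i × tgt D e ≡ y j)

  data UWalk (ok : Fin (E D) → Set) : Fin m → Fin m → Set where
    unil  : ∀ {v} → UWalk ok v v
    ufwd  : ∀ {w} (e : Fin (E D)) → ok e → UWalk ok (tgt D e) w → UWalk ok (src D e) w
    ubwd  : ∀ {w} (e : Fin (E D)) → ok e → UWalk ok (src D e) w → UWalk ok (tgt D e) w

  -- the underlying undirected multigraph stays connected after deleting
  -- any two edges e₁, e₂ (e₁ ≡ e₂ covers deleting a single edge)
  ThreeEdgeConnected : Set
  ThreeEdgeConnected =
    ∀ (e₁ e₂ : Fin (E D)) (u v : Fin m) →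
      UWalk (λ e → e ≢ e₁ × e ≢ e₂) u v

  module _ (y : Fin m → Fin m) where

    countIn2 : ℕ → ℕ
    countIn2 k = length (filter (λ p → indeg (y p) Data.Nat.≟ 2)
                          (filter (λ p → toℕ p Data.Nat.<? k) (allFin m)))

    countOut2 : ℕ → ℕ
    countOut2 k = length (filter (λ p → outdeg (y p) Data.Nat.≟ 2)
                           (filter (λ p → toℕ p Data.Nat.<? k) (allFin m)))

    Condition1 : Set
    Condition1 = Σ ℕ λ k → k ≤ m × countOut2 k < countIn2 k

    InInterval : Fin m → Fin m → Fin m → Set
    InInterval i j v = Σ (Fin m) λ p → y p ≡ v × toℕ i ≤ toℕ p × toℕ p ≤ toℕ j

    Crossing : Fin m → Fin m → Fin (E D) → Set
    Crossing i j e =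
      (InInterval i j (src D e) × ¬ InInterval i j (tgt D e)) ⊎
      (¬ InInterval i j (src D e) × InInterval i j (tgt D e))

    -- (2) an interval [y_i, y_j] with 2 ≤ i ≤ j ≤ m-1 (1-based; here
    -- 0-based positions 1 ≤ i ≤ j ≤ m-2) whose only crossing edges are
    -- an edge (y_{i-1}, y_i) and an edge (y_j, y_{j+1})
    Condition2 : Set
    Condition2 =
      Σ (Fin m) λ i → Σ (Fin m) λ j → Σ (Fin m) λ p → Σ (Fin m) λ q →
        toℕ p + 1 ≡ toℕ i × toℕ i ≤ toℕ j × toℕ q ≡ suc (toℕ j) ×
        Σ (Fin (E D)) λ e₁ → Σ (Fin (E D)) λ e₂ →
          src D e₁ ≡ y p × tgt D e₁ ≡ y i ×
          src D e₂ ≡ y j × tgt D e₂ ≡ y q ×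
          (∀ e → Crossing i j e → e ≡ e₁ ⊎ e ≡ e₂)

-- Number the vertices by their position on the Hamiltonian path y. Acyclicity forces every
-- edge to go forward, so the edges leaving the first k vertices are exactly the edges of the
-- k-th cut of the path. In a 3-regular graph the source y₁ has outdegree 3, the sink yₘ
-- indegree 3, and every other vertex degrees (1,2) or (2,1); double counting then gives, for
-- 1 ≤ k < m,
--   |cut k| = 3 + #(outdegree 2 among y₁ … y_k) − #(indegree 2 among y₁ … y_k),
-- while the two counts agree for k = m. Hence (1) holds exactly when some cut has at most two
-- edges, and deleting them disconnects the graph; (2) exhibits a two-edge cut directly.
-- Conversely, suppose every cut has at least three edges and delete two edges e₁, e₂. Only the
-- path steps leaving the sources of e₁ and e₂ can break, so the path falls into at most three
-- blocks. A surviving cut edge rejoins the outer blocks, and the middle block is rejoined too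
-- unless its only crossing edges are e₁ and e₂, which is condition (2).
module Submission where

open import Defs
open import Data.Nat using (ℕ)
open import Data.Fin using (Fin)
open import Data.Sum using (_⊎_)
open import Relation.Nullary using (¬_)
open import Function.Bundles using (_⇔_; mk⇔)

open import Data.Bool.Base using (true; false; if_then_else_)
open import Data.Fin as Fin using (toℕ; punchOut)
open import Data.Fin.Properties
  using (any?; sequence; injective⇒≤; punchOut-injective; toℕ<n; toℕ-injective)
  renaming (_≟_ to _≟ᶠ_)
open import Data.List.Base using (List; []; _∷_; length; filter; allFin; tabulate)
open import Data.List.Membership.Propositional using (_∈_)
open import Data.List.Membership.Propositional.Properties using (∈-filter⁺; ∈-allFin)
open import Data.List.Properties using (filter-none; filter-some)
import Data.List.Relation.Unary.All.Properties as All
open import Data.List.Relation.Unary.Any as Any using (here; there)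
open import Data.Nat.Base using (zero; suc; _+_; _*_; _≤_; _<_; z≤n; s≤s; s≤s⁻¹; _≤‴_; ≤‴-refl; ≤‴-step)
open import Data.Nat.Properties
  using (_≟_; _<?_; _≤?_; <-cmp; anyUpTo?;
         ≤-refl; ≤-reflexive; ≤-trans; <-trans; <-≤-trans; ≤-<-trans; <⇒≤; ≤‴⇒≤; ≤⇒≤‴;
         <⇒≱; ≮⇒≥; ≰⇒>; <⇒≢; >⇒≢; n≮0; n≮n; 1+n≰n; n<1+n; m<n⇒m<1+n; n≢0⇒n>0;
         m≤n⇒m<n∨m≡n; m≤n⇒m≤1+n; m≤m+n; m≤n+m;
         +-comm; +-assoc; +-identityʳ; *-distribʳ-+; +-cancelˡ-≡; +-cancelʳ-<; +-cancelʳ-≤;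
         +-mono-≤; +-monoʳ-≤; +-monoʳ-<; +-commutativeSemigroup; +-0-commutativeMonoid;
         module ≤-Reasoning)
open import Algebra.Properties.CommutativeSemigroup +-commutativeSemigroup using (interchange; x∙yz≈y∙xz)
open import Algebra.Properties.CommutativeMonoid.Sum +-0-commutativeMonoid
  using (sum; ∑-distrib-+; sum-cong-≗; sum-replicate-zero)
open import Data.Product.Base using (∃; ∃₂; _×_; _,_; proj₁; proj₂)
open import Data.Sum.Base using (inj₁; inj₂; [_,_]′; swap)
open import Data.Sum.Effectful.Right using (applicative)
open import Function.Base using (_∘_; id)
open import Function.Definitions using (Injective)
open import Level using (0ℓ)
open import Relation.Binary.Definitions using (tri<; tri≈; tri>)
open import Relation.Binary.PropositionalEquality
  using (_≡_; _≢_; refl; sym; trans; cong; cong₂; subst; subst₂; module ≡-Reasoning)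
open import Relation.Nullary.Decidable
  using (Dec; yes; no; does; _×-dec_; _⊎-dec_; ¬?; map′; does-⇔; dec-true; dec-false)
open import Relation.Nullary.Negation using (contradiction)
open import Relation.Unary using (Pred; Decidable)

-- Iverson brackets and counting

⟦_⟧ : ∀ {a} {A : Set a} → Dec A → ℕ
⟦ a? ⟧ = if does a? then 1 else 0

⟦yes⟧ : ∀ {a} {A : Set a} (a? : Dec A) → A → ⟦ a? ⟧ ≡ 1
⟦yes⟧ a? a = cong (if_then 1 else 0) (dec-true a? a)

⟦no⟧ : ∀ {a} {A : Set a} (a? : Dec A) → ¬ A → ⟦ a? ⟧ ≡ 0
⟦no⟧ a? ¬a = cong (if_then 1 else 0) (dec-false a? ¬a)

⟦⟧-cong : ∀ {a b} {A : Set a} {B : Set b} → A ⇔ B → (a? : Dec A) (b? : Dec B) → ⟦ a? ⟧ ≡ ⟦ b? ⟧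
⟦⟧-cong A⇔B a? b? = cong (if_then 1 else 0) (does-⇔ A⇔B a? b?)

⟦×-dec⟧ : ∀ {a b} {A : Set a} {B : Set b} (a? : Dec A) (b? : Dec B) → ⟦ a? ×-dec b? ⟧ ≡ ⟦ a? ⟧ * ⟦ b? ⟧
⟦×-dec⟧ a? b? with does a?
... | true  = sym (+-identityʳ ⟦ b? ⟧)
... | false = refl

⟦<?-suc⟧ : ∀ a k → ⟦ a <? suc k ⟧ ≡ ⟦ a <? k ⟧ + ⟦ a ≟ k ⟧
⟦<?-suc⟧ a k with <-cmp a k
... | tri< a<k a≢k _   = trans (⟦yes⟧ (a <? suc k) (m<n⇒m<1+n a<k))
                               (sym (cong₂ _+_ (⟦yes⟧ (a <? k) a<k) (⟦no⟧ (a ≟ k) a≢k)))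
... | tri≈ a≮k a≡k _   = trans (⟦yes⟧ (a <? suc k) (s≤s (≤-reflexive a≡k)))
                               (sym (cong₂ _+_ (⟦no⟧ (a <? k) a≮k) (⟦yes⟧ (a ≟ k) a≡k)))
... | tri> a≮k a≢k k<a = trans (⟦no⟧ (a <? suc k) (<⇒≱ k<a ∘ s≤s⁻¹))
                               (sym (cong₂ _+_ (⟦no⟧ (a <? k) a≮k) (⟦no⟧ (a ≟ k) a≢k)))

⟦<?⟧-split : ∀ {a b} k → a < b → ⟦ a <? k ⟧ ≡ ⟦ b <? k ⟧ + ⟦ (a <? k) ×-dec (k ≤? b) ⟧
⟦<?⟧-split {a} {b} k a<b with b <? k
... | yes b<k = trans (⟦yes⟧ (a <? k) (<-trans a<b b<k))
                      (sym (cong₂ _+_ (⟦yes⟧ (b <? k) b<k)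
                                      (⟦no⟧ ((a <? k) ×-dec (k ≤? b)) (λ (_ , k≤b) → <⇒≱ b<k k≤b))))
... | no b≮k  = trans (⟦⟧-cong (mk⇔ (_, ≮⇒≥ b≮k) proj₁) (a <? k) ((a <? k) ×-dec (k ≤? b)))
                      (sym (cong (_+ ⟦ (a <? k) ×-dec (k ≤? b) ⟧) (⟦no⟧ (b <? k) b≮k)))

degree-balance : ∀ {i o} → i + o ≡ 3 → 1 ≤ i → 1 ≤ o → o + ⟦ i ≟ 2 ⟧ ≡ i + ⟦ o ≟ 2 ⟧
degree-balance {1} {2}                         _  _  _  = refl
degree-balance {2} {1}                         _  _  _  = refl
degree-balance {0}                             _  () _
degree-balance {_} {0}                         _  _  ()
degree-balance {1} {1}                         () _  _
degree-balance {1} {suc (suc (suc _))}         () _  _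
degree-balance {2} {suc (suc _)}               () _  _
degree-balance {3} {suc _}                     () _  _
degree-balance {suc (suc (suc (suc _)))} {suc _} () _ _

module _ {a p} {A : Set a} {P : Pred A p} (P? : Decidable P) where

  length-filter-tabulate : ∀ {n} (f : Fin n → A) → length (filter P? (tabulate f)) ≡ sum (λ i → ⟦ P? (f i) ⟧)
  length-filter-tabulate {zero}  f = refl
  length-filter-tabulate {suc n} f with does (P? (f Fin.zero))
  ... | true  = cong suc (length-filter-tabulate (f ∘ Fin.suc))
  ... | false = length-filter-tabulate (f ∘ Fin.suc)

  filter-filter : ∀ {q} {Q : Pred A q} (Q? : Decidable Q) (xs : List A) →
                  filter Q? (filter P? xs) ≡ filter (λ x → P? x ×-dec Q? x) xs
  filter-filter Q? []       = refl
  filter-filter Q? (x ∷ xs) with does (P? x)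
  ... | false = filter-filter Q? xs
  ... | true with does (Q? x)
  ...   | false = filter-filter Q? xs
  ...   | true  = cong (x ∷_) (filter-filter Q? xs)

short-list-covered : ∀ {a} {A : Set a} → A → (xs : List A) → length xs ≤ 2 →
                     ∃₂ λ x₁ x₂ → ∀ {x} → x ∈ xs → x ≡ x₁ ⊎ x ≡ x₂
short-list-covered default []              _ = default , default , λ ()
short-list-covered _       (a ∷ [])        _ = a , a , λ { (here refl) → inj₁ refl }
short-list-covered _       (a ∷ b ∷ [])    _ =
  a , b , λ { (here refl) → inj₁ refl ; (there (here refl)) → inj₂ refl }
short-list-covered _       (_ ∷ _ ∷ _ ∷ _) (s≤s (s≤s ()))

-- Matches the shape of indeg and outdeg, which are therefore counts by definition.
count : ∀ {n p} {P : Pred (Fin n) p} → Decidable P → ℕ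
count {n} P? = length (filter P? (allFin n))

module _ {n : ℕ} where

  count≡sum : ∀ {p} {P : Pred (Fin n) p} (P? : Decidable P) → count P? ≡ sum (λ i → ⟦ P? i ⟧)
  count≡sum P? = length-filter-tabulate P? id

  count-split : ∀ {p q r} {P : Pred (Fin n) p} {Q : Pred (Fin n) q} {R : Pred (Fin n) r}
                (P? : Decidable P) (Q? : Decidable Q) (R? : Decidable R) →
                (∀ i → ⟦ P? i ⟧ ≡ ⟦ Q? i ⟧ + ⟦ R? i ⟧) → count P? ≡ count Q? + count R?
  count-split P? Q? R? split = begin
    count P?                                     ≡⟨ count≡sum P? ⟩
    sum (λ i → ⟦ P? i ⟧)                         ≡⟨ sum-cong-≗ split ⟩
    sum (λ i → ⟦ Q? i ⟧ + ⟦ R? i ⟧)              ≡⟨ ∑-distrib-+ (λ i → ⟦ Q? i ⟧) (λ i → ⟦ R? i ⟧) ⟩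
    sum (λ i → ⟦ Q? i ⟧) + sum (λ i → ⟦ R? i ⟧)  ≡⟨ cong₂ _+_ (count≡sum Q?) (count≡sum R?) ⟨
    count Q? + count R?                          ∎
    where open ≡-Reasoning

  count-none : ∀ {p} {P : Pred (Fin n) p} (P? : Decidable P) → (∀ i → ¬ P i) → count P? ≡ 0
  count-none P? none = cong length (filter-none P? (All.tabulate⁺ none))

  1≤count : ∀ {p} {P : Pred (Fin n) p} (P? : Decidable P) {i} → P i → 1 ≤ count P?
  1≤count P? {i} Pi = filter-some P? (Any.map (λ i≡j → subst _ i≡j Pi) (∈-allFin i))

  count-≟ : (d : Fin n) → count (_≟ᶠ d) ≡ 1
  count-≟ d = trans (count≡sum (_≟ᶠ d)) (sum-⟦≟⟧ d)
    where
    sum-⟦≟⟧ : ∀ {n} (d : Fin n) → sum (λ i → ⟦ i ≟ᶠ d ⟧) ≡ 1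
    sum-⟦≟⟧ {suc n} Fin.zero = cong suc (sum-replicate-zero n)
    sum-⟦≟⟧ (Fin.suc d)      = sum-⟦≟⟧ d

  count-at : ∀ {q} {Q : Pred (Fin n) q} (Q? : Decidable Q) (d : Fin n) →
             count (λ i → (i ≟ᶠ d) ×-dec Q? i) ≡ ⟦ Q? d ⟧
  count-at Q? d = trans (count≡sum (λ i → (i ≟ᶠ d) ×-dec Q? i)) (sum-at Q? d)
    where
    sum-at : ∀ {n q} {Q : Pred (Fin n) q} (Q? : Decidable Q) (d : Fin n) →
             sum (λ i → ⟦ (i ≟ᶠ d) ×-dec Q? i ⟧) ≡ ⟦ Q? d ⟧
    sum-at {suc n} Q? Fin.zero = trans (cong (⟦ Q? Fin.zero ⟧ +_) (sum-replicate-zero n)) (+-identityʳ _)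
    sum-at Q? (Fin.suc d)      = sum-at (Q? ∘ Fin.suc) d

  module _ {p} {P : Pred (Fin n) p} (P? : Decidable P) where

    covered⇒count≤2 : ∀ {e₁ e₂} → (∀ i → P i → i ≡ e₁ ⊎ i ≡ e₂) → count P? ≤ 2
    covered⇒count≤2 {e₁} {e₂} covered = begin
      count P?                                           ≡⟨ count≡sum P? ⟩
      sum (λ i → ⟦ P? i ⟧)                               ≤⟨ sum-mono-≤ ⟦P⟧≤ ⟩
      sum (λ i → ⟦ i ≟ᶠ e₁ ⟧ + ⟦ i ≟ᶠ e₂ ⟧)
        ≡⟨ ∑-distrib-+ (λ i → ⟦ i ≟ᶠ e₁ ⟧) (λ i → ⟦ i ≟ᶠ e₂ ⟧) ⟩
      sum (λ i → ⟦ i ≟ᶠ e₁ ⟧) + sum (λ i → ⟦ i ≟ᶠ e₂ ⟧)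
        ≡⟨ cong₂ _+_ (count≡sum (_≟ᶠ e₁)) (count≡sum (_≟ᶠ e₂)) ⟨
      count (_≟ᶠ e₁) + count (_≟ᶠ e₂)
        ≡⟨ cong₂ _+_ (count-≟ e₁) (count-≟ e₂) ⟩
      2 ∎
      where
      open ≤-Reasoning
      sum-mono-≤ : ∀ {n} {f g : Fin n → ℕ} → (∀ i → f i ≤ g i) → sum f ≤ sum g
      sum-mono-≤ {zero}  f≤g = z≤n
      sum-mono-≤ {suc n} f≤g = +-mono-≤ (f≤g Fin.zero) (sum-mono-≤ (f≤g ∘ Fin.suc))
      ⟦P⟧≤ : ∀ i → ⟦ P? i ⟧ ≤ ⟦ i ≟ᶠ e₁ ⟧ + ⟦ i ≟ᶠ e₂ ⟧
      ⟦P⟧≤ i with P? i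
      ... | no _ = z≤n
      ... | yes Pi with covered i Pi
      ...   | inj₁ refl = ≤-trans (≤-reflexive (sym (⟦yes⟧ (i ≟ᶠ i) refl))) (m≤m+n _ _)
      ...   | inj₂ refl = ≤-trans (≤-reflexive (sym (⟦yes⟧ (i ≟ᶠ i) refl))) (m≤n+m _ _)

    3≤count⇒avoids-two : ∀ e₁ e₂ → 3 ≤ count P? → ∃ λ i → P i × i ≢ e₁ × i ≢ e₂
    3≤count⇒avoids-two e₁ e₂ 3≤count with any? (λ i → P? i ×-dec ¬? (i ≟ᶠ e₁) ×-dec ¬? (i ≟ᶠ e₂))
    ... | yes avoiding = avoiding
    ... | no  none     = contradiction (covered⇒count≤2 covered) (<⇒≱ 3≤count)
      where
      covered : ∀ i → P i → i ≡ e₁ ⊎ i ≡ e₂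
      covered i Pi with i ≟ᶠ e₁ | i ≟ᶠ e₂
      ... | yes i≡e₁ | _        = inj₁ i≡e₁
      ... | no _     | yes i≡e₂ = inj₂ i≡e₂
      ... | no i≢e₁  | no i≢e₂  = contradiction (i , Pi , i≢e₁ , i≢e₂) none

    count≤2⇒covered : Fin n → count P? ≤ 2 → ∃₂ λ e₁ e₂ → ∀ i → P i → i ≡ e₁ ⊎ i ≡ e₂
    count≤2⇒covered default count≤2 =
      let e₁ , e₂ , covered = short-list-covered default (filter P? (allFin n)) count≤2
      in  e₁ , e₂ , λ i Pi → covered (∈-filter⁺ P? (∈-allFin i) Pi)

-- countIn2 D y and countOut2 D y are countBelow by definition.
module _ {N q} {Q : Pred (Fin N) q} (Q? : Decidable Q) where

  countBelow : ℕ → ℕ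
  countBelow k = length (filter Q? (filter (λ i → toℕ i <? k) (allFin N)))

  countBelow-zero : countBelow 0 ≡ 0
  countBelow-zero =
    cong (length ∘ filter Q?) (filter-none (λ i → toℕ i <? 0) (All.tabulate⁺ {f = id} (λ _ → n≮0)))

  countBelow-suc : ∀ p → countBelow (suc (toℕ p)) ≡ countBelow (toℕ p) + ⟦ Q? p ⟧
  countBelow-suc p = begin
    countBelow (suc (toℕ p))
      ≡⟨ cong length (filter-filter (λ i → toℕ i <? suc (toℕ p)) Q? (allFin N)) ⟩
    count (λ i → (toℕ i <? suc (toℕ p)) ×-dec Q? i)
      ≡⟨ count-split _ (λ i → (toℕ i <? toℕ p) ×-dec Q? i) (λ i → (i ≟ᶠ p) ×-dec Q? i) split ⟩
    count (λ i → (toℕ i <? toℕ p) ×-dec Q? i) + count (λ i → (i ≟ᶠ p) ×-dec Q? i)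
      ≡⟨ cong₂ _+_ (cong length (filter-filter (λ i → toℕ i <? toℕ p) Q? (allFin N)))
                   (sym (count-at Q? p)) ⟨
    countBelow (toℕ p) + ⟦ Q? p ⟧
      ∎
    where
    open ≡-Reasoning
    split : ∀ i → ⟦ (toℕ i <? suc (toℕ p)) ×-dec Q? i ⟧
                ≡ ⟦ (toℕ i <? toℕ p) ×-dec Q? i ⟧ + ⟦ (i ≟ᶠ p) ×-dec Q? i ⟧
    split i = begin
      ⟦ (toℕ i <? suc (toℕ p)) ×-dec Q? i ⟧
        ≡⟨ ⟦×-dec⟧ (toℕ i <? suc (toℕ p)) (Q? i) ⟩
      ⟦ toℕ i <? suc (toℕ p) ⟧ * ⟦ Q? i ⟧
        ≡⟨ cong (_* ⟦ Q? i ⟧) (⟦<?-suc⟧ (toℕ i) (toℕ p)) ⟩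
      (⟦ toℕ i <? toℕ p ⟧ + ⟦ toℕ i ≟ toℕ p ⟧) * ⟦ Q? i ⟧
        ≡⟨ cong (λ x → (⟦ toℕ i <? toℕ p ⟧ + x) * ⟦ Q? i ⟧)
                (⟦⟧-cong (mk⇔ toℕ-injective (cong toℕ)) (toℕ i ≟ toℕ p) (i ≟ᶠ p)) ⟩
      (⟦ toℕ i <? toℕ p ⟧ + ⟦ i ≟ᶠ p ⟧) * ⟦ Q? i ⟧
        ≡⟨ *-distribʳ-+ ⟦ Q? i ⟧ ⟦ toℕ i <? toℕ p ⟧ ⟦ i ≟ᶠ p ⟧ ⟩
      ⟦ toℕ i <? toℕ p ⟧ * ⟦ Q? i ⟧ + ⟦ i ≟ᶠ p ⟧ * ⟦ Q? i ⟧
        ≡⟨ cong₂ _+_ (⟦×-dec⟧ (toℕ i <? toℕ p) (Q? i)) (⟦×-dec⟧ (i ≟ᶠ p) (Q? i)) ⟨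
      ⟦ (toℕ i <? toℕ p) ×-dec Q? i ⟧ + ⟦ (i ≟ᶠ p) ×-dec Q? i ⟧
        ∎

condition1? : ∀ {m} (D : Digraph m) (y : Fin m → Fin m) → Dec (Condition1 D y)
condition1? {m} D y = map′ (λ (k , k<1+m , more-in2) → k , s≤s⁻¹ k<1+m , more-in2)
                           (λ (k , k≤m , more-in2) → k , s≤s k≤m , more-in2)
                           (anyUpTo? (λ k → countOut2 D y k <? countIn2 D y k) (suc m))

-- Undirected walks and edge cuts

module _ {m} (D : Digraph m) {Kept : Pred (Fin (E D)) 0ℓ} where

  uwalk-trans : ∀ {u v w} → UWalk D Kept u v → UWalk D Kept v w → UWalk D Kept u w
  uwalk-trans unil            q = q
  uwalk-trans (ufwd e kept p) q = ufwd e kept (uwalk-trans p q)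
  uwalk-trans (ubwd e kept p) q = ubwd e kept (uwalk-trans p q)

  uwalk-sym : ∀ {u v} → UWalk D Kept u v → UWalk D Kept v u
  uwalk-sym unil            = unil
  uwalk-sym (ufwd e kept p) = uwalk-trans (uwalk-sym p) (ubwd e kept unil)
  uwalk-sym (ubwd e kept p) = uwalk-trans (uwalk-sym p) (ufwd e kept unil)

Crosses : ∀ {m ℓ} (D : Digraph m) → Pred (Fin m) ℓ → Pred (Fin (E D)) ℓ
Crosses D S e = (S (src D e) × ¬ S (tgt D e)) ⊎ (¬ S (src D e) × S (tgt D e))

module _ {m ℓ} (D : Digraph m) {S : Pred (Fin m) ℓ} (S? : Decidable S) where

  uwalk-crossing : ∀ {Kept u v} → UWalk D Kept u v → S u → ¬ S v → ∃ λ e → Kept e × Crosses D S e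
  uwalk-crossing unil            Su ¬Sv = contradiction Su ¬Sv
  uwalk-crossing (ufwd e kept p) Su ¬Sv with S? (tgt D e)
  ... | yes St = uwalk-crossing p St ¬Sv
  ... | no ¬St = e , kept , inj₁ (Su , ¬St)
  uwalk-crossing (ubwd e kept p) Su ¬Sv with S? (src D e)
  ... | yes Ss = uwalk-crossing p Ss ¬Sv
  ... | no ¬Ss = e , kept , inj₂ (¬Ss , Su)

  two-edge-cut⇒¬3-edge-connected : ∀ {u v e₁ e₂} → S u → ¬ S v →
    (∀ e → Crosses D S e → e ≡ e₁ ⊎ e ≡ e₂) → ¬ ThreeEdgeConnected D
  two-edge-cut⇒¬3-edge-connected {u} {v} {e₁} {e₂} Su ¬Sv cut⊆ 3ec
    with e , (e≢e₁ , e≢e₂) , crosses ← uwalk-crossing (3ec e₁ e₂ u v) Su ¬Sv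
    = [ e≢e₁ , e≢e₂ ]′ (cut⊆ e crosses)

module _ {m} (D : Digraph m) (y : Fin m → Fin m) where

  inInterval? : ∀ i j → Decidable (InInterval D y i j)
  inInterval? i j v = any? (λ p → (y p ≟ᶠ v) ×-dec (toℕ i ≤? toℕ p) ×-dec (toℕ p ≤? toℕ j))

  condition2⇒¬3-edge-connected : Injective _≡_ _≡_ y → Condition2 D y → ¬ ThreeEdgeConnected D
  condition2⇒¬3-edge-connected y-inj (i , j , p , _ , p+1≡i , i≤j , _ , e₁ , e₂ , _ , _ , _ , _ , cover) =
    two-edge-cut⇒¬3-edge-connected D (inInterval? i j) (i , refl , ≤-refl , i≤j) yp∉[i,j] cover
    where
    yp∉[i,j] : ¬ InInterval D y i j (y p)
    yp∉[i,j] (p′ , yp′≡yp , i≤p′ , _) =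
      <⇒≱ (≤-reflexive (trans (+-comm 1 (toℕ p)) p+1≡i)) (subst (λ r → toℕ i ≤ toℕ r) (y-inj yp′≡yp) i≤p′)

-- Positions along the Hamiltonian path

injective⇒surjective : ∀ {n} {f : Fin n → Fin n} → Injective _≡_ _≡_ f → ∀ v → ∃ λ p → f p ≡ v
injective⇒surjective {suc n} {f} f-inj v with any? (λ p → f p ≟ᶠ v)
... | yes hit  = hit
... | no  miss = contradiction (injective⇒≤ g-inj) 1+n≰n
  where
  g : Fin (suc n) → Fin n
  g p = punchOut (λ v≡fp → miss (p , sym v≡fp))
  g-inj : Injective _≡_ _≡_ g
  g-inj {p} {q} =
    f-inj ∘ punchOut-injective {i = v} (λ v≡fp → miss (p , sym v≡fp)) (λ v≡fq → miss (q , sym v≡fq))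

-- Saturates at the last element; it is only ever applied to k ≤ n.
clamp : ∀ {n} → ℕ → Fin (suc n)
clamp {zero}  _       = Fin.zero
clamp {suc n} zero    = Fin.zero
clamp {suc n} (suc k) = Fin.suc (clamp k)

toℕ-clamp : ∀ {n k} → k ≤ n → toℕ (clamp {n} k) ≡ k
toℕ-clamp {zero}  z≤n       = refl
toℕ-clamp {suc n} z≤n       = refl
toℕ-clamp {suc n} (s≤s k≤n) = cong suc (toℕ-clamp k≤n)

clamp-toℕ : ∀ {n} (p : Fin (suc n)) → clamp (toℕ p) ≡ p
clamp-toℕ {zero}  Fin.zero    = refl
clamp-toℕ {suc n} Fin.zero    = refl
clamp-toℕ {suc n} (Fin.suc p) = cong Fin.suc (clamp-toℕ p)

module HamiltonianOrder {n} (D : Digraph (suc n)) (y : Fin (suc n) → Fin (suc n))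
                        (acyclic : Acyclic D) (hamiltonian : IsHamiltonianPath D y) where

  -- Positions are 0-based: Y k is the vertex written y_{k+1} in the paper.
  Y : ℕ → Fin (suc n)
  Y k = y (clamp k)

  position : Fin (suc n) → Fin (suc n)
  position v = proj₁ (injective⇒surjective (proj₁ hamiltonian) v)

  y-position : ∀ v → y (position v) ≡ v
  y-position v = proj₂ (injective⇒surjective (proj₁ hamiltonian) v)

  pos : Fin (suc n) → ℕ
  pos v = toℕ (position v)

  pos≤n : ∀ v → pos v ≤ n
  pos≤n v = s≤s⁻¹ (toℕ<n (position v))

  pos-y : ∀ p → pos (y p) ≡ toℕ p
  pos-y p = cong toℕ (proj₁ hamiltonian (y-position (y p)))

  Y-pos : ∀ v → Y (pos v) ≡ v
  Y-pos v = trans (cong y (clamp-toℕ (position v))) (y-position v)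

  pos-Y : ∀ {k} → k ≤ n → pos (Y k) ≡ k
  pos-Y {k} k≤n = trans (pos-y (clamp k)) (toℕ-clamp k≤n)

  pos≡⇒≡Y : ∀ {v k} → pos v ≡ k → v ≡ Y k
  pos≡⇒≡Y {v} pos≡k = trans (sym (Y-pos v)) (cong Y pos≡k)

  srcPos tgtPos : Fin (E D) → ℕ
  srcPos e = pos (src D e)
  tgtPos e = pos (tgt D e)

  path-edge : ∀ {p} → p < n → ∃ λ e → src D e ≡ Y p × tgt D e ≡ Y (suc p)
  path-edge {p} p<n = proj₂ hamiltonian (clamp p) (clamp (suc p))
    (trans (toℕ-clamp p<n) (cong suc (sym (toℕ-clamp (<⇒≤ p<n)))))

  path-edge-positions : ∀ {p e} → p < n → src D e ≡ Y p → tgt D e ≡ Y (suc p) →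
                        srcPos e ≡ p × tgtPos e ≡ suc p
  path-edge-positions p<n src≡ tgt≡ =
    trans (cong pos src≡) (pos-Y (<⇒≤ p<n)) , trans (cong pos tgt≡) (pos-Y p<n)

  path-walk : ∀ {a b} → a ≤‴ b → b ≤ n → ∃ (DWalk D (Y a) (Y b))
  path-walk ≤‴-refl _ = 0 , nil
  path-walk {a} {b} (≤‴-step a<b) b≤n
    with e , src≡ , tgt≡ ← path-edge (<-≤-trans (≤‴⇒≤ a<b) b≤n)
       | l , rest ← path-walk a<b b≤n
    = suc l , subst (λ v → DWalk D v (Y b) (suc l)) src≡
                (cons e (subst (λ v → DWalk D v (Y b) l) (sym tgt≡) rest))

  srcPos<tgtPos : ∀ e → srcPos e < tgtPos e
  srcPos<tgtPos e with srcPos e <? tgtPos e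
  ... | yes forward = forward
  ... | no ¬forward
    with l , back ← path-walk (≤⇒≤‴ (≮⇒≥ ¬forward)) (pos≤n (src D e))
    = contradiction (cons e (subst₂ (λ u v → DWalk D u v l) (Y-pos (tgt D e)) (Y-pos (src D e)) back))
                    (acyclic (src D e) l)

  srcPos<n : ∀ e → srcPos e < n
  srcPos<n e = <-≤-trans (srcPos<tgtPos e) (pos≤n (tgt D e))

  Bridge : ℕ → ℕ → ℕ → Pred (Fin (E D)) 0ℓ
  Bridge lo k hi e = lo ≤ srcPos e × srcPos e < k × k ≤ tgtPos e × tgtPos e < hi

  bridge? : ∀ lo k hi → Decidable (Bridge lo k hi)
  bridge? lo k hi e = (lo ≤? srcPos e) ×-dec (srcPos e <? k) ×-dec (k ≤? tgtPos e) ×-dec (tgtPos e <? hi)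

  inInterval⇒ : ∀ {i j v} → InInterval D y i j v → toℕ i ≤ pos v × pos v ≤ toℕ j
  inInterval⇒ {i} {j} {v} (p , yp≡v , i≤p , p≤j) = subst (toℕ i ≤_) p≡v i≤p , subst (_≤ toℕ j) p≡v p≤j
    where
    p≡v : toℕ p ≡ pos v
    p≡v = trans (sym (pos-y p)) (cong pos yp≡v)

  ⇒inInterval : ∀ {i j v} → toℕ i ≤ pos v → pos v ≤ toℕ j → InInterval D y i j v
  ⇒inInterval {v = v} i≤v v≤j = position v , y-position v , i≤v , v≤j

  crossing⇒bridge : ∀ {i j e} → Crossing D y i j e →
    Bridge 0 (toℕ i) (suc (toℕ j)) e ⊎ Bridge (toℕ i) (suc (toℕ j)) (suc n) e
  crossing⇒bridge {e = e} (inj₁ (src∈ , tgt∉)) =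
    let i≤s , s≤j = inInterval⇒ src∈
        j<t       = ≰⇒> (tgt∉ ∘ ⇒inInterval (≤-trans i≤s (<⇒≤ (srcPos<tgtPos e))))
    in  inj₂ (i≤s , s≤s s≤j , j<t , s≤s (pos≤n (tgt D e)))
  crossing⇒bridge {e = e} (inj₂ (src∉ , tgt∈)) =
    let i≤t , t≤j = inInterval⇒ tgt∈
        s<i       = ≰⇒> (λ i≤s → src∉ (⇒inInterval i≤s (≤-trans (<⇒≤ (srcPos<tgtPos e)) t≤j)))
    in  inj₁ (z≤n , s<i , i≤t , s≤s t≤j)

  indeg-Y0 : indeg D (Y 0) ≡ 0
  indeg-Y0 = count-none (λ e → tgt D e ≟ᶠ Y 0)
    (λ e tgt≡Y0 → n≮0 (subst (srcPos e <_) (trans (cong pos tgt≡Y0) (pos-Y z≤n)) (srcPos<tgtPos e)))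

  outdeg-Yn : outdeg D (Y n) ≡ 0
  outdeg-Yn = count-none (λ e → src D e ≟ᶠ Y n)
    (λ e src≡Yn → n≮n n (subst (_< n) (trans (cong pos src≡Yn) (pos-Y ≤-refl)) (srcPos<n e)))

  1≤indeg : ∀ {p} → p < n → 1 ≤ indeg D (Y (suc p))
  1≤indeg p<n = 1≤count (λ e → tgt D e ≟ᶠ _) (proj₂ (proj₂ (path-edge p<n)))

  1≤outdeg : ∀ {p} → p < n → 1 ≤ outdeg D (Y p)
  1≤outdeg p<n = 1≤count (λ e → src D e ≟ᶠ _) (proj₁ (proj₂ (path-edge p<n)))

  outPrefix inPrefix cutSize : ℕ → ℕ
  outPrefix k = count (λ e → srcPos e <? k)
  inPrefix  k = count (λ e → tgtPos e <? k)
  cutSize   k = count (λ e → (srcPos e <? k) ×-dec (k ≤? tgtPos e))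

  ⟦pos≟⟧ : ∀ {k} → k ≤ n → ∀ v → ⟦ pos v ≟ k ⟧ ≡ ⟦ v ≟ᶠ Y k ⟧
  ⟦pos≟⟧ k≤n v =
    ⟦⟧-cong (mk⇔ pos≡⇒≡Y (λ v≡Yk → trans (cong pos v≡Yk) (pos-Y k≤n))) (pos v ≟ _) (v ≟ᶠ Y _)

  outPrefix-zero : outPrefix 0 ≡ 0
  outPrefix-zero = count-none (λ e → srcPos e <? 0) (λ _ → n≮0)

  inPrefix-zero : inPrefix 0 ≡ 0
  inPrefix-zero = count-none (λ e → tgtPos e <? 0) (λ _ → n≮0)

  outPrefix-suc : ∀ {k} → k ≤ n → outPrefix (suc k) ≡ outPrefix k + outdeg D (Y k)
  outPrefix-suc {k} k≤n =
    count-split (λ e → srcPos e <? suc k) (λ e → srcPos e <? k) (λ e → src D e ≟ᶠ Y k)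
      (λ e → trans (⟦<?-suc⟧ (srcPos e) k) (cong (⟦ srcPos e <? k ⟧ +_) (⟦pos≟⟧ k≤n (src D e))))

  inPrefix-suc : ∀ {k} → k ≤ n → inPrefix (suc k) ≡ inPrefix k + indeg D (Y k)
  inPrefix-suc {k} k≤n =
    count-split (λ e → tgtPos e <? suc k) (λ e → tgtPos e <? k) (λ e → tgt D e ≟ᶠ Y k)
      (λ e → trans (⟦<?-suc⟧ (tgtPos e) k) (cong (⟦ tgtPos e <? k ⟧ +_) (⟦pos≟⟧ k≤n (tgt D e))))

  outPrefix≡inPrefix+cutSize : ∀ k → outPrefix k ≡ inPrefix k + cutSize k
  outPrefix≡inPrefix+cutSize k =
    count-split (λ e → srcPos e <? k) (λ e → tgtPos e <? k) (λ e → (srcPos e <? k) ×-dec (k ≤? tgtPos e))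
      (λ e → ⟦<?⟧-split k (srcPos<tgtPos e))

  cutSize-whole : cutSize (suc n) ≡ 0
  cutSize-whole = count-none (λ e → (srcPos e <? suc n) ×-dec (suc n ≤? tgtPos e))
    (λ e (_ , n<t) → <⇒≱ n<t (pos≤n (tgt D e)))

  countIn2-suc : ∀ {k} → k ≤ n → countIn2 D y (suc k) ≡ countIn2 D y k + ⟦ indeg D (Y k) ≟ 2 ⟧
  countIn2-suc {k} k≤n = subst (λ j → countIn2 D y (suc j) ≡ countIn2 D y j + ⟦ indeg D (Y k) ≟ 2 ⟧)
    (toℕ-clamp k≤n) (countBelow-suc (λ p → indeg D (y p) ≟ 2) (clamp k))

  countOut2-suc : ∀ {k} → k ≤ n → countOut2 D y (suc k) ≡ countOut2 D y k + ⟦ outdeg D (Y k) ≟ 2 ⟧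
  countOut2-suc {k} k≤n = subst (λ j → countOut2 D y (suc j) ≡ countOut2 D y j + ⟦ outdeg D (Y k) ≟ 2 ⟧)
    (toℕ-clamp k≤n) (countBelow-suc (λ p → outdeg D (y p) ≟ 2) (clamp k))

  small-cut⇒¬3-edge-connected : ∀ {k} → 1 ≤ k → k ≤ n → cutSize k ≤ 2 → ¬ ThreeEdgeConnected D
  small-cut⇒¬3-edge-connected {k} 1≤k k≤n cut≤2
    with e₁ , e₂ , covered ← count≤2⇒covered (λ e → (srcPos e <? k) ×-dec (k ≤? tgtPos e))
                                             (proj₁ (path-edge (<-≤-trans 1≤k k≤n))) cut≤2
    = two-edge-cut⇒¬3-edge-connected D (λ v → pos v <? k) Y0-before Yk-after crossing⇒removed
    where
    Y0-before : pos (Y 0) < k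
    Y0-before = subst (_< k) (sym (pos-Y z≤n)) 1≤k
    Yk-after : ¬ pos (Y k) < k
    Yk-after = n≮n k ∘ subst (_< k) (pos-Y k≤n)
    crossing⇒removed : ∀ e → Crosses D (λ v → pos v < k) e → e ≡ e₁ ⊎ e ≡ e₂
    crossing⇒removed e (inj₁ (s<k , t≮k)) = covered e (s<k , ≮⇒≥ t≮k)
    crossing⇒removed e (inj₂ (s≮k , t<k)) = contradiction (<-trans (srcPos<tgtPos e) t<k) s≮k

  -- Reconnecting the path after deleting two edges

  module Reconnection (3≤cutSize : ∀ {k} → 1 ≤ k → k ≤ n → 3 ≤ cutSize k) (e₁ e₂ : Fin (E D)) where

    Kept : Pred (Fin (E D)) 0ℓ
    Kept e = e ≢ e₁ × e ≢ e₂

    kept? : Decidable Kept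
    kept? e = ¬? (e ≟ᶠ e₁) ×-dec ¬? (e ≟ᶠ e₂)

    removed : ∀ {e} → ¬ Kept e → e ≡ e₁ ⊎ e ≡ e₂
    removed {e} ¬kept with e ≟ᶠ e₁ | e ≟ᶠ e₂
    ... | yes e≡e₁ | _        = inj₁ e≡e₁
    ... | no _     | yes e≡e₂ = inj₂ e≡e₂
    ... | no e≢e₁  | no e≢e₂  = contradiction (e≢e₁ , e≢e₂) ¬kept

    _~_ : Fin (suc n) → Fin (suc n) → Set
    _~_ = UWalk D Kept

    Intact : ℕ → Set
    Intact p = ∃ λ e → Kept e × src D e ≡ Y p × tgt D e ≡ Y (suc p)

    intact? : Decidable Intact
    intact? p = any? (λ e → kept? e ×-dec (src D e ≟ᶠ Y p) ×-dec (tgt D e ≟ᶠ Y (suc p)))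

    Linked : ℕ → ℕ → Set
    Linked lo hi = ∀ q → lo ≤ q → q < hi → Y lo ~ Y q

    linked-along-path : ∀ {lo hi} → (∀ {p} → lo ≤ p → suc p < hi → Intact p) → Linked lo hi
    linked-along-path intact zero    z≤n      _      = unil
    linked-along-path intact (suc q) lo≤q+1 q+1<hi with m≤n⇒m<n∨m≡n lo≤q+1
    ... | inj₂ refl   = unil
    ... | inj₁ lo<q+1 with e , kept , src≡ , tgt≡ ← intact (s≤s⁻¹ lo<q+1) q+1<hi =
      uwalk-trans D (linked-along-path intact q (s≤s⁻¹ lo<q+1) (<-trans (n<1+n q) q+1<hi))
                    (subst₂ _~_ src≡ tgt≡ (ufwd e kept unil))

    linked-join : ∀ {lo k hi} → Linked lo k → Linked k hi → (∃ λ e → Kept e × Bridge lo k hi e) → Linked lo hi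
    linked-join {k = k} left right (e , kept , lo≤s , s<k , k≤t , t<hi) q lo≤q q<hi with q <? k
    ... | yes q<k = left q lo≤q q<k
    ... | no  q≮k =
      uwalk-trans D (left (srcPos e) lo≤s s<k)
        (uwalk-trans D (subst₂ _~_ (sym (Y-pos (src D e))) (sym (Y-pos (tgt D e))) (ufwd e kept unil))
          (uwalk-trans D (uwalk-sym D (right (tgtPos e) k≤t t<hi)) (right q (≮⇒≥ q≮k) q<hi)))

    linked⇒connected : Linked 0 (suc n) → ∀ u v → u ~ v
    linked⇒connected linked u v = subst₂ _~_ (Y-pos u) (Y-pos v)
      (uwalk-trans D (uwalk-sym D (linked (pos u) z≤n (s≤s (pos≤n u)))) (linked (pos v) z≤n (s≤s (pos≤n v))))

    kept-cut-edge : ∀ {k} → 1 ≤ k → k ≤ n → ∃ λ e → Kept e × Bridge 0 k (suc n) e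
    kept-cut-edge {k} 1≤k k≤n
      with e , (s<k , k≤t) , e≢e₁ , e≢e₂ ← 3≤count⇒avoids-two (λ e → (srcPos e <? k) ×-dec (k ≤? tgtPos e))
                                                                e₁ e₂ (3≤cutSize 1≤k k≤n)
      = e , (e≢e₁ , e≢e₂) , z≤n , s<k , k≤t , s≤s (pos≤n (tgt D e))

    module Ordered (f₁ f₂ : Fin (E D)) (removed′ : ∀ {e} → ¬ Kept e → e ≡ f₁ ⊎ e ≡ f₂)
                   (a≤b : srcPos f₁ ≤ srcPos f₂) where

      a b : ℕ
      a = srcPos f₁
      b = srcPos f₂

      a<n : a < n
      a<n = srcPos<n f₁

      b<n : b < n
      b<n = srcPos<n f₂

      removed-path-edge : ∀ {p} → p < n → (∀ {e} → srcPos e ≡ p → tgtPos e ≡ suc p → ¬ Kept e) →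
                          (a ≡ p × tgtPos f₁ ≡ suc p) ⊎ (b ≡ p × tgtPos f₂ ≡ suc p)
      removed-path-edge p<n unkept
        with h , src≡ , tgt≡ ← path-edge p<n
        with s≡p , t≡p+1 ← path-edge-positions p<n src≡ tgt≡
        with removed′ (unkept s≡p t≡p+1)
      ... | inj₁ refl = inj₁ (s≡p , t≡p+1)
      ... | inj₂ refl = inj₂ (s≡p , t≡p+1)

      intact-elsewhere : ∀ {p} → p < n → p ≢ a → p ≢ b → Intact p
      intact-elsewhere {p} p<n p≢a p≢b with intact? p
      ... | yes intact = intact
      ... | no  broken = contradiction
          (removed-path-edge p<n λ {e} s≡p t≡p+1 kept → broken (e , kept , pos≡⇒≡Y s≡p , pos≡⇒≡Y t≡p+1))
          [ p≢a ∘ sym ∘ proj₁ , p≢b ∘ sym ∘ proj₁ ]′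

      linked-block : ∀ {lo hi} → hi ≤ suc n → (∀ {p} → lo ≤ p → suc p < hi → p ≢ a × p ≢ b) → Linked lo hi
      linked-block hi≤1+n avoids = linked-along-path λ lo≤p p+1<hi →
        let p≢a , p≢b = avoids lo≤p p+1<hi
        in  intact-elsewhere (s≤s⁻¹ (<-≤-trans p+1<hi hi≤1+n)) p≢a p≢b

      before-a : Linked 0 (suc a)
      before-a = linked-block (s≤s (<⇒≤ a<n)) λ _ p+1<a+1 →
        let p<a = s≤s⁻¹ p+1<a+1 in <⇒≢ p<a , <⇒≢ (<-≤-trans p<a a≤b)

      between : Linked (suc a) (suc b)
      between = linked-block (s≤s (<⇒≤ b<n)) λ a<p p+1<b+1 → >⇒≢ a<p , <⇒≢ (s≤s⁻¹ p+1<b+1)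

      after-b : Linked (suc b) (suc n)
      after-b = linked-block ≤-refl λ b<p _ → >⇒≢ (≤-<-trans a≤b b<p) , >⇒≢ b<p

      isolated⇒condition2 : a < b →
        (∀ e → Kept e → ¬ (Bridge 0 (suc a) (suc b) e ⊎ Bridge (suc a) (suc b) (suc n) e)) → Condition2 D y
      isolated⇒condition2 a<b isolated =
        position (tgt D f₁) , position (src D f₂) , position (src D f₁) , position (tgt D f₂) ,
        trans (+-comm a 1) (sym t₁≡a+1) , subst (_≤ b) (sym t₁≡a+1) a<b , t₂≡b+1 ,
        f₁ , f₂ , sym (y-position _) , sym (y-position _) , sym (y-position _) , sym (y-position _) ,
        crossing⇒removed
        where
        t₁≡a+1 : tgtPos f₁ ≡ suc a
        t₁≡a+1 with removed-path-edge a<n (λ s≡a t≡a+1 kept → isolated _ kept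
                      (inj₁ (z≤n , ≤-reflexive (cong suc s≡a) , ≤-reflexive (sym t≡a+1) ,
                             subst (_< suc b) (sym t≡a+1) (s≤s a<b))))
        ... | inj₁ (_ , t≡a+1) = t≡a+1
        ... | inj₂ (b≡a , _)   = contradiction b≡a (>⇒≢ a<b)
        t₂≡b+1 : tgtPos f₂ ≡ suc b
        t₂≡b+1 with removed-path-edge b<n (λ s≡b t≡b+1 kept → isolated _ kept
                      (inj₂ (subst (suc a ≤_) (sym s≡b) a<b , ≤-reflexive (cong suc s≡b) ,
                             ≤-reflexive (sym t≡b+1) , subst (_< suc n) (sym t≡b+1) (s≤s b<n))))
        ... | inj₁ (a≡b , _)   = contradiction a≡b (<⇒≢ a<b)
        ... | inj₂ (_ , t≡b+1) = t≡b+1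
        crossing⇒removed : ∀ e → Crossing D y (position (tgt D f₁)) (position (src D f₂)) e → e ≡ f₁ ⊎ e ≡ f₂
        crossing⇒removed e crossing = removed′ λ kept → isolated e kept
          (subst (λ i → Bridge 0 i (suc b) e ⊎ Bridge i (suc b) (suc n) e) t₁≡a+1 (crossing⇒bridge crossing))

      reconnect : (∀ u v → u ~ v) ⊎ Condition2 D y
      reconnect with m≤n⇒m<n∨m≡n a≤b
      ... | inj₂ a≡b = inj₁ (linked⇒connected
              (linked-join before-a (subst (λ k → Linked (suc k) (suc n)) (sym a≡b) after-b)
                           (kept-cut-edge (s≤s z≤n) a<n)))
      ... | inj₁ a<b
        with any? (λ e → kept? e ×-dec (bridge? 0 (suc a) (suc b) e ⊎-dec bridge? (suc a) (suc b) (suc n) e))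
      ...   | yes (e , kept , inj₁ into-between) = inj₁ (linked⇒connected
              (linked-join (linked-join before-a between (e , kept , into-between)) after-b
                           (kept-cut-edge (s≤s z≤n) b<n)))
      ...   | yes (e , kept , inj₂ out-of-between) = inj₁ (linked⇒connected
              (linked-join before-a (linked-join between after-b (e , kept , out-of-between))
                           (kept-cut-edge (s≤s z≤n) a<n)))
      ...   | no none = inj₂ (isolated⇒condition2 a<b λ e kept bridge → none (e , kept , bridge))

    connected-or-condition2 : (∀ u v → u ~ v) ⊎ Condition2 D y
    connected-or-condition2 with srcPos e₁ ≤? srcPos e₂
    ... | yes a≤b = Ordered.reconnect e₁ e₂ removed a≤b
    ... | no  a≰b = Ordered.reconnect e₂ e₁ (swap ∘ removed) (<⇒≤ (≰⇒> a≰b))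

  -- The cut-size identity for 3-regular graphs

  module _ (regular : ThreeRegular D) where

    outdeg-Y0 : outdeg D (Y 0) ≡ 3
    outdeg-Y0 = subst (λ d → d + outdeg D (Y 0) ≡ 3) indeg-Y0 (regular (Y 0))

    indeg-Yn : indeg D (Y n) ≡ 3
    indeg-Yn = trans (sym (+-identityʳ _)) (subst (λ d → indeg D (Y n) + d ≡ 3) outdeg-Yn (regular (Y n)))

    1≤n : 1 ≤ n
    1≤n = n≢0⇒n>0 λ n≡0 →
      contradiction (trans (sym outdeg-Y0) (subst (λ k → outdeg D (Y k) ≡ 0) n≡0 outdeg-Yn)) λ ()

    outContribution inContribution : Fin (suc n) → ℕ
    outContribution v = outdeg D v + ⟦ indeg D v ≟ 2 ⟧
    inContribution  v = indeg D v + ⟦ outdeg D v ≟ 2 ⟧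

    source-contribution : outContribution (Y 0) ≡ 3 + inContribution (Y 0)
    source-contribution = trans (cong₂ (λ i o → o + ⟦ i ≟ 2 ⟧) indeg-Y0 outdeg-Y0)
                                (sym (cong₂ (λ i o → 3 + (i + ⟦ o ≟ 2 ⟧)) indeg-Y0 outdeg-Y0))

    sink-contribution : 3 + outContribution (Y n) ≡ inContribution (Y n)
    sink-contribution = trans (cong₂ (λ i o → 3 + (o + ⟦ i ≟ 2 ⟧)) indeg-Yn outdeg-Yn)
                              (sym (cong₂ (λ i o → i + ⟦ o ≟ 2 ⟧) indeg-Yn outdeg-Yn))

    interior-contribution : ∀ {p} → 1 ≤ p → p < n → outContribution (Y p) ≡ inContribution (Y p)
    interior-contribution {suc p} _ p+1<n =
      degree-balance (regular (Y (suc p))) (1≤indeg (<-trans (n<1+n p) p+1<n)) (1≤outdeg p+1<n)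

    outTally inTally : ℕ → ℕ
    outTally k = outPrefix k + countIn2 D y k
    inTally  k = inPrefix k + countOut2 D y k

    outTally-zero : outTally 0 ≡ 0
    outTally-zero = cong₂ _+_ outPrefix-zero (countBelow-zero (λ p → indeg D (y p) ≟ 2))

    inTally-zero : inTally 0 ≡ 0
    inTally-zero = cong₂ _+_ inPrefix-zero (countBelow-zero (λ p → outdeg D (y p) ≟ 2))

    outTally-suc : ∀ {k} → k ≤ n → outTally (suc k) ≡ outTally k + outContribution (Y k)
    outTally-suc {k} k≤n = trans (cong₂ _+_ (outPrefix-suc k≤n) (countIn2-suc k≤n))
                                 (interchange (outPrefix k) (outdeg D (Y k)) (countIn2 D y k) ⟦ indeg D (Y k) ≟ 2 ⟧)

    inTally-suc : ∀ {k} → k ≤ n → inTally (suc k) ≡ inTally k + inContribution (Y k)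
    inTally-suc {k} k≤n = trans (cong₂ _+_ (inPrefix-suc k≤n) (countOut2-suc k≤n))
                                (interchange (inPrefix k) (indeg D (Y k)) (countOut2 D y k) ⟦ outdeg D (Y k) ≟ 2 ⟧)

    tally-gap : ∀ {k} → 1 ≤ k → k ≤ n → outTally k ≡ 3 + inTally k
    tally-gap {1} _ _ = begin
      outTally 1                              ≡⟨ outTally-suc z≤n ⟩
      outTally 0 + outContribution (Y 0)      ≡⟨ cong (_+ outContribution (Y 0)) outTally-zero ⟩
      outContribution (Y 0)                   ≡⟨ source-contribution ⟩
      3 + inContribution (Y 0)                ≡⟨ cong (λ t → 3 + (t + inContribution (Y 0))) inTally-zero ⟨
      3 + (inTally 0 + inContribution (Y 0))  ≡⟨ cong (3 +_) (inTally-suc z≤n) ⟨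
      3 + inTally 1                           ∎
      where open ≡-Reasoning
    tally-gap {suc (suc k)} _ k+2≤n = begin
      outTally (2 + k)                                    ≡⟨ outTally-suc (<⇒≤ k+2≤n) ⟩
      outTally (1 + k) + outContribution (Y (1 + k))      ≡⟨ cong₂ _+_ (tally-gap {suc k} (s≤s z≤n) (<⇒≤ k+2≤n))
                                                                       (interior-contribution (s≤s z≤n) k+2≤n) ⟩
      3 + inTally (1 + k) + inContribution (Y (1 + k))    ≡⟨ +-assoc 3 (inTally (1 + k)) (inContribution (Y (1 + k))) ⟩
      3 + (inTally (1 + k) + inContribution (Y (1 + k)))  ≡⟨ cong (3 +_) (inTally-suc (<⇒≤ k+2≤n)) ⟨
      3 + inTally (2 + k)                                 ∎
      where open ≡-Reasoning

    tally-whole : outTally (suc n) ≡ inTally (suc n)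
    tally-whole = begin
      outTally (suc n)                         ≡⟨ outTally-suc ≤-refl ⟩
      outTally n + outContribution (Y n)       ≡⟨ cong (_+ outContribution (Y n)) (tally-gap 1≤n ≤-refl) ⟩
      3 + inTally n + outContribution (Y n)    ≡⟨ trans (+-assoc 3 (inTally n) _) (x∙yz≈y∙xz 3 (inTally n) _) ⟩
      inTally n + (3 + outContribution (Y n))  ≡⟨ cong (inTally n +_) sink-contribution ⟩
      inTally n + inContribution (Y n)         ≡⟨ inTally-suc ≤-refl ⟨
      inTally (suc n)                          ∎
      where open ≡-Reasoning

    cutSize+countIn2 : ∀ {k} → 1 ≤ k → k ≤ n → cutSize k + countIn2 D y k ≡ 3 + countOut2 D y k
    cutSize+countIn2 {k} 1≤k k≤n = +-cancelˡ-≡ (inPrefix k) _ _ (begin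
      inPrefix k + (cutSize k + countIn2 D y k)  ≡⟨ +-assoc (inPrefix k) (cutSize k) (countIn2 D y k) ⟨
      inPrefix k + cutSize k + countIn2 D y k    ≡⟨ cong (_+ countIn2 D y k) (outPrefix≡inPrefix+cutSize k) ⟨
      outTally k                                 ≡⟨ tally-gap 1≤k k≤n ⟩
      3 + (inPrefix k + countOut2 D y k)         ≡⟨ x∙yz≈y∙xz 3 (inPrefix k) (countOut2 D y k) ⟩
      inPrefix k + (3 + countOut2 D y k)         ∎)
      where open ≡-Reasoning

    countIn2-whole : countIn2 D y (suc n) ≡ countOut2 D y (suc n)
    countIn2-whole = +-cancelˡ-≡ (inPrefix (suc n)) _ _ (begin
      inPrefix (suc n) + countIn2 D y (suc n)  ≡⟨ cong (_+ countIn2 D y (suc n)) inPrefix≡outPrefix ⟩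
      outTally (suc n)                         ≡⟨ tally-whole ⟩
      inTally (suc n)                          ∎)
      where
      open ≡-Reasoning
      inPrefix≡outPrefix : inPrefix (suc n) ≡ outPrefix (suc n)
      inPrefix≡outPrefix = sym (trans (outPrefix≡inPrefix+cutSize (suc n))
                                      (trans (cong (inPrefix (suc n) +_) cutSize-whole) (+-identityʳ _)))

    condition1⇒small-cut : Condition1 D y → ∃ λ k → 1 ≤ k × k ≤ n × cutSize k ≤ 2
    condition1⇒small-cut (zero , _ , more-in2) =
      contradiction (subst (countOut2 D y 0 <_) (countBelow-zero (λ p → indeg D (y p) ≟ 2)) more-in2) n≮0
    condition1⇒small-cut (suc k , k+1≤1+n , more-in2) with m≤n⇒m<n∨m≡n (s≤s⁻¹ k+1≤1+n)
    ... | inj₂ refl = contradiction (sym countIn2-whole) (<⇒≢ more-in2)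
    ... | inj₁ k<n  = suc k , s≤s z≤n , k<n ,
      s≤s⁻¹ (+-cancelʳ-< (countIn2 D y (suc k)) (cutSize (suc k)) 3
        (subst (_< 3 + countIn2 D y (suc k)) (sym (cutSize+countIn2 (s≤s z≤n) k<n)) (+-monoʳ-< 3 more-in2)))

    ¬condition1⇒3≤cutSize : ¬ Condition1 D y → ∀ {k} → 1 ≤ k → k ≤ n → 3 ≤ cutSize k
    ¬condition1⇒3≤cutSize ¬c1 {k} 1≤k k≤n =
      +-cancelʳ-≤ (countIn2 D y k) 3 (cutSize k)
        (subst (3 + countIn2 D y k ≤_) (sym (cutSize+countIn2 1≤k k≤n)) (+-monoʳ-≤ 3 in2≤out2))
      where
      in2≤out2 : countIn2 D y k ≤ countOut2 D y k
      in2≤out2 = ≮⇒≥ λ more-in2 → ¬c1 (k , m≤n⇒m≤1+n k≤n , more-in2)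

    condition1⇒¬3-edge-connected : Condition1 D y → ¬ ThreeEdgeConnected D
    condition1⇒¬3-edge-connected c1 =
      let k , 1≤k , k≤n , cut≤2 = condition1⇒small-cut c1
      in  small-cut⇒¬3-edge-connected 1≤k k≤n cut≤2

    ¬3-edge-connected⇒conditions : ¬ ThreeEdgeConnected D → Condition1 D y ⊎ Condition2 D y
    ¬3-edge-connected⇒conditions ¬3ec with condition1? D y
    ... | yes c1 = inj₁ c1
    ... | no ¬c1 with sequence (applicative _ _) (λ e₁ → sequence (applicative _ _) (λ e₂ →
                        Reconnection.connected-or-condition2 (¬condition1⇒3≤cutSize ¬c1) e₁ e₂))
    ...   | inj₁ 3ec = contradiction 3ec ¬3ec
    ...   | inj₂ c2  = inj₂ c2

-- Uniqueness of the source and sink follows from acyclicity and the Hamiltonian path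
-- (they are Y 0 and Y n), so UniqueSource is only used to rule out the empty graph.
proposition2p1 : ∀ {m : ℕ} (D : Digraph m) (y : Fin m → Fin m) →
    ThreeRegular D → Acyclic D → UniqueSource D → UniqueSink D →
    IsHamiltonianPath D y →
    (¬ ThreeEdgeConnected D) ⇔ (Condition1 D y ⊎ Condition2 D y)
proposition2p1 {zero}  D y _       _       (() , _) _ _
proposition2p1 {suc n} D y regular acyclic _        _ hamiltonian =
  mk⇔ (¬3-edge-connected⇒conditions regular)
      [ condition1⇒¬3-edge-connected regular , condition2⇒¬3-edge-connected D y (proj₁ hamiltonian) ]′
  where open HamiltonianOrder D y acyclic hamiltonian
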